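{- For $m\ge 3$, let $W_m$ be the wheel graph with $m$ rim vertices and let $\Delta$ be its maximum degree. Then $$\chi''_{\Sigma}(W_m)=\begin{cases}\Delta+1 & \text{if } m\ge 4,\\ \Delta+2 & \text{if } m=3.\end{cases}$$
   Context: All graphs are finite and simple. A proper total $k$-coloring of a graph $G$ assigns to every vertex and every edge a color from $\{1,\dots,k\}$ such that adjacent vertices receive different colors, edges sharing an endpoint receive different colors, and no edge receives the same color as either of its endpoints. For such a coloring $c$ and a vertex $v$, let $f(v)=c(v)+\sum_{e\ni v} c(e)$ (sum over edges incident to $v$). The coloring distinguishes adjacent vertices by sums if $f(u)\neq f(v)$ for every edge $uv$. $\chi''_{\Sigma}(G)$ (the adjacent vertex distinguishing index by sums) denotes the smallest $k$ such that $G$ has a proper total $k$-coloring distinguishing adjacent vertices by sums. The wheel $W_m$ consists of a cycle on $m$ vertices together with a central vertex adjacent to all of them; in particular $W_3=K_4$. -}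

module Defs where

open import Data.Nat using (ℕ; zero; suc; _+_; _≤_; _⊔_; _≡ᵇ_)
open import Data.Bool using (Bool; true; false; if_then_else_; _∧_; _∨_; not)
open import Data.Fin using (Fin; toℕ) renaming (zero to fz; suc to fs)
open import Data.List using (List; map; filter; length; foldr)
open import Data.Nat.ListAction using (sum)
open import Data.Bool.Properties using (∨-comm)
open import Relation.Binary.PropositionalEquality using (refl; cong; cong₂; sym)
open import Relation.Nullary using (yes; no)
open import Data.List using () renaming (allFin to allFinL)
open import Data.Fin using () renaming (_≟_ to _≟F_)
open import Data.Product using (_×_; Σ)
open import Relation.Binary.PropositionalEquality using (_≡_; _≢_)
open import Relation.Nullary using (¬_)
import Data.Empty
open import Relation.Nullary.Decidable using (does)

record Graph : Set where
  field
    order : ℕ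
    adj   : Fin order → Fin order → Bool
    adj-sym   : ∀ u v → adj u v ≡ adj v u
    adj-irrefl : ∀ v → adj v v ≡ false
open Graph public

nbrs : (G : Graph) → Fin (order G) → List (Fin (order G))
nbrs G v = filter (λ u → adj G v u Data.Bool.≟ true) (allFinL (order G))

degree : (G : Graph) → Fin (order G) → ℕ
degree G v = length (nbrs G v)

maxDegree : Graph → ℕ
maxDegree G = foldr _⊔_ 0 (map (degree G) (allFinL (order G)))

-- A total coloring: a color for each vertex, and a color for each ordered
-- pair of vertices (only meaningful for adjacent pairs; required symmetric there).
record TotalColoring (G : Graph) : Set where
  field
    vcol : Fin (order G) → ℕ
    ecol : Fin (order G) → Fin (order G) → ℕ
open TotalColoring public

Adj : (G : Graph) → Fin (order G) → Fin (order G) → Set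
Adj G u v = adj G u v ≡ true

weight : (G : Graph) → TotalColoring G → Fin (order G) → ℕ
weight G c v = vcol c v + sum (map (ecol c v) (nbrs G v))

record IsAVDTotalColoring (G : Graph) (k : ℕ) (c : TotalColoring G) : Set where
  field
    vcol-range : ∀ v → 1 ≤ vcol c v × vcol c v ≤ k
    ecol-range : ∀ u v → Adj G u v → 1 ≤ ecol c u v × ecol c u v ≤ k
    ecol-sym   : ∀ u v → Adj G u v → ecol c u v ≡ ecol c v u
    vertex-proper : ∀ u v → Adj G u v → vcol c u ≢ vcol c v
    edge-proper   : ∀ v u w → Adj G v u → Adj G v w → u ≢ w → ecol c v u ≢ ecol c v w
    incidence-proper : ∀ u v → Adj G u v → ecol c u v ≢ vcol c u
    sums-distinct : ∀ u v → Adj G u v → weight G c u ≢ weight G c v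

AVDColorable : Graph → ℕ → Set
AVDColorable G k = Σ (TotalColoring G) (IsAVDTotalColoring G k)

χΣ≡ : Graph → ℕ → Set
χΣ≡ G k = AVDColorable G k × (∀ j → AVDColorable G j → k ≤ j)

-- The wheel W_m: vertex fz is the center, fs i (i : Fin m) are rim vertices
-- forming the cycle 0 - 1 - … - (m-1) - 0.

next : ℕ → ℕ → ℕ
next m i = if suc i ≡ᵇ m then 0 else suc i

rimAdj : (m : ℕ) → Fin m → Fin m → Bool
rimAdj m i j = not (does (i ≟F j))
             ∧ ((next m (toℕ i) ≡ᵇ toℕ j) ∨ (next m (toℕ j) ≡ᵇ toℕ i))

wheelAdj : (m : ℕ) → Fin (suc m) → Fin (suc m) → Bool
wheelAdj m fz     fz     = false
wheelAdj m fz     (fs j) = true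
wheelAdj m (fs i) fz     = true
wheelAdj m (fs i) (fs j) = rimAdj m i j

private
  dsym : ∀ {m} (i j : Fin m) → does (i ≟F j) ≡ does (j ≟F i)
  dsym i j with i ≟F j | j ≟F i
  ... | yes _ | yes _ = refl
  ... | no _  | no _  = refl
  ... | yes p | no q  = Data.Empty.⊥-elim (q (sym p))
  ... | no p  | yes q = Data.Empty.⊥-elim (p (sym q))

  drefl : ∀ {m} (i : Fin m) → does (i ≟F i) ≡ true
  drefl i with i ≟F i
  ... | yes _ = refl
  ... | no p  = Data.Empty.⊥-elim (p refl)

wheelAdj-sym : ∀ m u v → wheelAdj m u v ≡ wheelAdj m v u
wheelAdj-sym m fz fz = refl
wheelAdj-sym m fz (fs j) = refl
wheelAdj-sym m (fs i) fz = refl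
wheelAdj-sym m (fs i) (fs j) =
  cong₂ _∧_ (cong not (dsym i j))
            (∨-comm (next m (toℕ i) ≡ᵇ toℕ j) (next m (toℕ j) ≡ᵇ toℕ i))

wheelAdj-irrefl : ∀ m v → wheelAdj m v v ≡ false
wheelAdj-irrefl m fz = refl
wheelAdj-irrefl m (fs i) rewrite drefl i = refl

wheel : ℕ → Graph
wheel m = record
  { order = suc m
  ; adj = wheelAdj m
  ; adj-sym = wheelAdj-sym m
  ; adj-irrefl = wheelAdj-irrefl m
  }

-- Lower bounds: the colour of the hub and of its m spokes are m + 1 distinct colours, so at least
-- Δ + 1 = m + 1 colours are needed.  In W₃ = K₄ with only 4 colours every vertex sees all of
-- {1,2,3,4} on itself and its incident edges, so all weights equal 10 and no edge is distinguished.
-- Upper bounds: explicit colourings for W₃ (5 colours) and W₄; for m ≥ 5, colour rim vertex x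
-- with x + 2, spoke x with x + 1, rim edge x(x+1) with x + 4 (rim indices mod m, colours in
-- 1..m) and the hub with m + 1.  Rim vertex x then has weight 4 + x + (x+1) + (x+2) + (x+3), so
-- adjacent rim vertices x, x+1 differ exactly when x ≢ x + 4 (mod m), i.e. m ≠ 4; the hub weight
-- m + 1 + m(m+1)/2 exceeds every rim weight, which is at most 4m.

module Submission where

open import Defs
open import Data.Nat using (ℕ; _+_; _≤_)
open import Data.Product using (_×_)
open import Relation.Binary.PropositionalEquality using (_≡_)

open import Algebra.Properties.CommutativeMonoid.Sum using ()
open import Data.Bool using (true; false; if_then_else_; not; _∧_; _∨_)
import Data.Bool as Bool
open import Data.Bool.Properties using (∨-zeroʳ)
open import Data.Empty using (⊥)
open import Data.Fin using (Fin; toℕ; fromℕ; fromℕ<; inject₁; punchIn) renaming (zero to fz; suc to fs)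
open import Data.Fin.Patterns using (0F; 1F; 2F; 3F; 4F)
open import Data.Fin.Properties
  using (toℕ<n; toℕ-injective; toℕ-fromℕ; toℕ-fromℕ<; toℕ-inject₁; injective⇒≤; all?; any?;
         punchIn-injective; punchInᵢ≢i)
  renaming (_≟_ to _≟F_)
open import Data.List using (List; []; _∷_; map; filter; length; foldr; tabulate; allFin; lookup)
open import Data.List.Membership.Propositional.Properties using (∈-lookup; ∈-filter⁻)
open import Data.List.Properties using (map-tabulate)
open import Data.List.Relation.Unary.All as All using (All; []; _∷_)
open import Data.List.Relation.Unary.All.Properties using (map⁺; tabulate⁺)
open import Data.List.Relation.Unary.AllPairs using (_∷_)
open import Data.List.Relation.Unary.Unique.Propositional using (Unique)
open import Data.List.Relation.Unary.Unique.Propositional.Properties using (allFin⁺; filter⁺)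
open import Data.Nat using (zero; suc; pred; _*_; _<_; _≤?_; _≡ᵇ_; _⊔_; z≤n; s≤s; NonZero; >-nonZero)
open import Data.Nat.GeneralisedArithmetic using (iterate)
open import Data.Nat.ListAction using (sum)
open import Data.Nat.Properties
open import Data.Nat.Tactic.RingSolver using (solve-∀)
open import Data.Product using (_,_; proj₁; proj₂; ∃-syntax)
open import Data.Sum using (_⊎_; inj₁; inj₂)
open import Data.Unit using (tt)
open import Data.Vec.Functional using (removeAt)
open import Function using (_∘_; id; Injective)
open import Level using (Level)
open import Relation.Binary.PropositionalEquality
  using (_≢_; refl; sym; trans; cong; cong₂; subst; module ≡-Reasoning)
open import Relation.Nullary using (Dec; ¬_; yes; no; ¬?; contradiction)
open import Relation.Nullary.Decidable using (does; _×-dec_; _→-dec_; map′; from-yes)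
open import Relation.Unary using (Pred; Decidable)

open Algebra.Properties.CommutativeMonoid.Sum +-0-commutativeMonoid
  using (sum-remove; sum-cong-≗; ∑-distrib-+) renaming (sum to ∑)

private
  variable
    a p : Level
    A : Set a
    n k : ℕ

sum-tabulate : (g : Fin n → ℕ) → sum (tabulate g) ≡ ∑ g
sum-tabulate {n = zero}  g = refl
sum-tabulate {n = suc n} g = cong (g fz +_) (sum-tabulate (g ∘ fs))

sum-map-allFin : (f : Fin n → ℕ) → sum (map f (allFin n)) ≡ ∑ f
sum-map-allFin f = trans (cong sum (map-tabulate id f)) (sum-tabulate f)

sum-map-lookup : (f : A → ℕ) (xs : List A) → sum (map f xs) ≡ ∑ (f ∘ lookup xs)
sum-map-lookup f []       = refl
sum-map-lookup f (x ∷ xs) = cong (f x +_) (sum-map-lookup f xs)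

sum-map-filter : {P : Pred A p} (P? : Decidable P) (f : A → ℕ) (xs : List A) →
  sum (map f (filter P? xs)) ≡ sum (map (λ x → if does (P? x) then f x else 0) xs)
sum-map-filter P? f [] = refl
sum-map-filter P? f (x ∷ xs) with does (P? x)
... | true  = cong (f x +_) (sum-map-filter P? f xs)
... | false = sum-map-filter P? f xs

length≡sum-map-1 : (xs : List A) → length xs ≡ sum (map (λ _ → 1) xs)
length≡sum-map-1 []       = refl
length≡sum-map-1 (x ∷ xs) = cong suc (length≡sum-map-1 xs)

∑-indicator : (i : Fin n) (g : Fin n → ℕ) → ∑ (λ j → if does (j ≟F i) then g j else 0) ≡ g i
∑-indicator {n = suc n} fz     g = trans (cong (g fz +_) (∑-zero n)) (+-identityʳ (g fz))
  where
  ∑-zero : ∀ n → ∑ {n} (λ _ → 0) ≡ 0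
  ∑-zero zero    = refl
  ∑-zero (suc n) = ∑-zero n
∑-indicator {n = suc n} (fs i) g = ∑-indicator i (g ∘ fs)

lookup-injective : {xs : List A} → Unique xs → Injective _≡_ _≡_ (lookup xs)
lookup-injective (_  ∷ _) {fz}   {fz}   _ = refl
lookup-injective (x≢ ∷ _) {fz}   {fs j} e = contradiction e (All.lookup x≢ (∈-lookup j))
lookup-injective (x≢ ∷ _) {fs i} {fz}   e = contradiction (sym e) (All.lookup x≢ (∈-lookup i))
lookup-injective (_  ∷ u) {fs i} {fs j} e = cong fs (lookup-injective u e)

_∈[1,_] : ℕ → ℕ → Set
x ∈[1, k ] = 1 ≤ x × x ≤ k

injective⇒≤-colours : (g : Fin n → ℕ) → (∀ i → g i ∈[1, k ]) → Injective _≡_ _≡_ g → n ≤ k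
injective⇒≤-colours {k = k} g range inj = injective⇒≤ {f = shift} shift-injective
  where
  instance
    g-nonZero : ∀ {i} → NonZero (g i)
    g-nonZero {i} = >-nonZero (proj₁ (range i))
  pred<k : ∀ i → pred (g i) < k
  pred<k i = ≤-trans (≤-reflexive (suc-pred (g i))) (proj₂ (range i))
  shift : Fin _ → Fin k
  shift i = fromℕ< (pred<k i)
  shift-injective : Injective _≡_ _≡_ shift
  shift-injective {i} {j} e = inj (begin
    g i              ≡⟨ sym (suc-pred (g i)) ⟩
    suc (pred (g i)) ≡⟨ cong suc (trans (sym (toℕ-fromℕ< (pred<k i))) (trans (cong toℕ e) (toℕ-fromℕ< (pred<k j)))) ⟩
    suc (pred (g j)) ≡⟨ suc-pred (g j) ⟩
    g j              ∎)
    where open ≡-Reasoning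

-- The colour n occurs (pigeonhole); removing it leaves an injective map into [1, n − 1].
injective-colours-sum : ∀ n (g : Fin n → ℕ) → (∀ i → g i ∈[1, n ]) → Injective _≡_ _≡_ g →
  2 * ∑ g ≡ n * suc n
injective-colours-sum zero    g range inj = refl
injective-colours-sum (suc n) g range inj with any? (λ i → g i ≟ suc n)
... | no  ¬top       = contradiction (injective⇒≤-colours g below inj) 1+n≰n
  where
  below : ∀ i → g i ∈[1, n ]
  below i = proj₁ (range i) , m<1+n⇒m≤n (≤∧≢⇒< (proj₂ (range i)) (¬top ∘ (i ,_)))
... | yes (i , g[i]≡top) = begin
  2 * ∑ g                     ≡⟨ cong (2 *_) (sum-remove {i = i} g) ⟩
  2 * (g i + ∑ rest)          ≡⟨ cong (λ t → 2 * (t + ∑ rest)) g[i]≡top ⟩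
  2 * (suc n + ∑ rest)        ≡⟨ *-distribˡ-+ 2 (suc n) (∑ rest) ⟩
  2 * suc n + 2 * ∑ rest      ≡⟨ cong (2 * suc n +_) (injective-colours-sum n rest rest-range rest-injective) ⟩
  2 * suc n + n * suc n       ≡⟨ sym (*-distribʳ-+ (suc n) 2 n) ⟩
  suc (suc n) * suc n         ≡⟨ *-comm (suc (suc n)) (suc n) ⟩
  suc n * suc (suc n)         ∎
  where
  open ≡-Reasoning
  rest : Fin n → ℕ
  rest = removeAt g i
  rest-injective : Injective _≡_ _≡_ rest
  rest-injective e = punchIn-injective i _ _ (inj e)
  rest-range : ∀ j → rest j ∈[1, n ]
  rest-range j = proj₁ (range (punchIn i j)) , m<1+n⇒m≤n (≤∧≢⇒< (proj₂ (range (punchIn i j)))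
    λ e → punchInᵢ≢i i j (inj (trans e (sym g[i]≡top))))

-- The colours at a vertex

module _ (G : Graph) (c : TotalColoring G) (v : Fin (order G)) where

  starColour : Fin (suc (degree G v)) → ℕ
  starColour fz     = vcol c v
  starColour (fs j) = ecol c v (lookup (nbrs G v) j)

  weight≡∑starColour : weight G c v ≡ ∑ starColour
  weight≡∑starColour = cong (vcol c v +_) (sum-map-lookup (ecol c v) (nbrs G v))

  private
    adj? : Decidable (Adj G v)
    adj? u = adj G v u Bool.≟ true

    lookup-nbrs-adj : ∀ j → Adj G v (lookup (nbrs G v) j)
    lookup-nbrs-adj j = proj₂ (∈-filter⁻ adj? {xs = allFin (order G)} (∈-lookup j))

    lookup-nbrs-injective : Injective _≡_ _≡_ (lookup (nbrs G v))
    lookup-nbrs-injective = lookup-injective (filter⁺ adj? (allFin⁺ (order G)))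

  module _ {k : ℕ} (P : IsAVDTotalColoring G k c) where
    open IsAVDTotalColoring P

    starColour-range : ∀ i → starColour i ∈[1, k ]
    starColour-range fz     = vcol-range v
    starColour-range (fs j) = ecol-range v _ (lookup-nbrs-adj j)

    starColour-injective : Injective _≡_ _≡_ starColour
    starColour-injective {fz}   {fz}   _ = refl
    starColour-injective {fz}   {fs j} e = contradiction (sym e) (incidence-proper v _ (lookup-nbrs-adj j))
    starColour-injective {fs i} {fz}   e = contradiction e (incidence-proper v _ (lookup-nbrs-adj i))
    starColour-injective {fs i} {fs j} e with i ≟F j
    ... | yes i≡j = cong fs i≡j
    ... | no  i≢j = contradiction e
      (edge-proper v _ _ (lookup-nbrs-adj i) (lookup-nbrs-adj j) (i≢j ∘ lookup-nbrs-injective))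

    degree<colours : degree G v < k
    degree<colours = injective⇒≤-colours starColour starColour-range starColour-injective

    full-star-weight : suc (degree G v) ≡ k → 2 * weight G c v ≡ k * suc k
    full-star-weight refl = trans (cong (2 *_) weight≡∑starColour)
      (injective-colours-sum k starColour starColour-range starColour-injective)

full-stars-adjacent-⊥ : ∀ {G k c} → IsAVDTotalColoring G k c → ∀ {u v} → Adj G u v →
  suc (degree G u) ≡ k → suc (degree G v) ≡ k → ⊥
full-stars-adjacent-⊥ {G} {k} {c} P {u} {v} adj full-u full-v =
  IsAVDTotalColoring.sums-distinct P u v adj (*-cancelˡ-≡ _ _ 2
    (trans (full-star-weight G c u P full-u) (sym (full-star-weight G c v P full-v))))

-- The cyclic successor on the rim

next-wrap : ∀ {m x} → suc x ≡ m → next m x ≡ 0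
next-wrap {m} {x} e with suc x ≡ᵇ m | ≡⇒≡ᵇ (suc x) m e
... | true | _ = refl

next-step : ∀ {m x} → suc x ≢ m → next m x ≡ suc x
next-step {m} {x} ne with suc x ≡ᵇ m | ≡ᵇ⇒≡ (suc x) m
... | true  | to≡ = contradiction (to≡ tt) ne
... | false | _   = refl

next-< : ∀ {m x} → x < m → next m x < m
next-< {m} {x} x<m with suc x ≟ m
... | yes sx≡m = subst (_< m) (sym (next-wrap sx≡m)) (≤-<-trans z≤n x<m)
... | no  sx≢m = subst (_< m) (sym (next-step sx≢m)) (≤∧≢⇒< x<m sx≢m)

next-injective : ∀ {m x y} → next m x ≡ next m y → x ≡ y
next-injective {m} {x} {y} e with suc x ≟ m | suc y ≟ m
... | yes sx≡m | yes sy≡m = suc-injective (trans sx≡m (sym sy≡m))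
... | yes sx≡m | no  sy≢m = contradiction (trans (sym (next-wrap sx≡m)) (trans e (next-step sy≢m))) λ ()
... | no  sx≢m | yes sy≡m = contradiction (trans (sym (next-wrap sy≡m)) (trans (sym e) (next-step sx≢m))) λ ()
... | no  sx≢m | no  sy≢m = suc-injective (trans (sym (next-step sx≢m)) (trans e (next-step sy≢m)))

iterate-next-period : ∀ m x k → ∃[ c ] x + k ≡ iterate (next m) x k + c * m
iterate-next-period m x zero    = 0 , refl
iterate-next-period m x (suc k) with c , e ← iterate-next-period m (next m x) k | suc x ≟ m
... | no  sx≢m = c , (begin
  x + suc k      ≡⟨ +-suc x k ⟩
  suc x + k      ≡⟨ cong (_+ k) (sym (next-step sx≢m)) ⟩
  next m x + k   ≡⟨ e ⟩
  iterate (next m) (next m x) k + c * m ∎)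
  where open ≡-Reasoning
... | yes sx≡m = suc c , (begin
  x + suc k                  ≡⟨ +-suc x k ⟩
  suc x + k                  ≡⟨ cong₂ _+_ sx≡m (cong (_+ k) (sym (next-wrap sx≡m))) ⟩
  m + (next m x + k)         ≡⟨ cong (m +_) e ⟩
  m + (it + c * m)           ≡⟨ regroup m it c ⟩
  it + suc c * m             ∎)
  where
  open ≡-Reasoning
  it : ℕ
  it = iterate (next m) (next m x) k
  regroup : ∀ m t c → m + (t + c * m) ≡ t + suc c * m
  regroup = solve-∀

iterate-next-≢ : ∀ {m} x k → 0 < k → k < m → iterate (next m) x k ≢ x
iterate-next-≢ {m} x k 0<k k<m it≡x with c , e ← iterate-next-period m x k
  with c | +-cancelˡ-≡ x k (c * m) (trans e (cong (_+ c * m) it≡x))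
... | zero   | k≡0      = <-irrefl (sym k≡0) 0<k
... | suc c′ | k≡m+c′m  = <-irrefl refl (<-≤-trans k<m (subst (m ≤_) (sym k≡m+c′m) (m≤m+n m (c′ * m))))

RimNeighbours : ∀ m → Fin m → Fin m → Set
RimNeighbours m i j = toℕ j ≡ next m (toℕ i) ⊎ next m (toℕ j) ≡ toℕ i

rimAdj⇒ : ∀ {m} {i j : Fin m} → rimAdj m i j ≡ true → RimNeighbours m i j
rimAdj⇒ {m} {i} {j} adj with does (i ≟F j) | next m (toℕ i) ≡ᵇ toℕ j | ≡ᵇ⇒≡ (next m (toℕ i)) (toℕ j)
                            | next m (toℕ j) ≡ᵇ toℕ i | ≡ᵇ⇒≡ (next m (toℕ j)) (toℕ i)
... | false | true  | to≡ | _     | _   = inj₁ (sym (to≡ tt))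
... | false | false | _   | true  | to≡ = inj₂ (to≡ tt)

rimAdj⇐ : ∀ {m} {i j : Fin m} → 1 < m → RimNeighbours m i j → rimAdj m i j ≡ true
rimAdj⇐ {m} {i} {j} 1<m nb = cong₂ _∧_ (distinct nb) (adjacent nb)
  where
  next-≢ : ∀ x → next m x ≢ x
  next-≢ x = iterate-next-≢ x 1 (s≤s z≤n) 1<m
  ≡ᵇ-true : ∀ {x y} → x ≡ y → (x ≡ᵇ y) ≡ true
  ≡ᵇ-true {x} {y} e with x ≡ᵇ y | ≡⇒≡ᵇ x y e
  ... | true | _ = refl
  distinct : RimNeighbours m i j → not (does (i ≟F j)) ≡ true
  distinct nb with i ≟F j
  distinct _        | no  _    = refl
  distinct (inj₁ e) | yes refl = contradiction (sym e) (next-≢ (toℕ i))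
  distinct (inj₂ e) | yes refl = contradiction e (next-≢ (toℕ i))
  adjacent : RimNeighbours m i j → ((next m (toℕ i) ≡ᵇ toℕ j) ∨ (next m (toℕ j) ≡ᵇ toℕ i)) ≡ true
  adjacent (inj₁ e) = cong (_∨ (next m (toℕ j) ≡ᵇ toℕ i)) (≡ᵇ-true (sym e))
  adjacent (inj₂ e) = trans (cong ((next m (toℕ i) ≡ᵇ toℕ j) ∨_) (≡ᵇ-true e)) (∨-zeroʳ _)

rimSucc : ∀ {m} → Fin m → Fin m
rimSucc {m} i = fromℕ< (next-< {m} (toℕ<n i))

toℕ-rimSucc : ∀ {m} (i : Fin m) → toℕ (rimSucc i) ≡ next m (toℕ i)
toℕ-rimSucc {m} i = toℕ-fromℕ< (next-< {m} (toℕ<n i))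

rimPred : ∀ {m} → Fin m → Fin m
rimPred {suc m} fz     = fromℕ m
rimPred {suc m} (fs j) = inject₁ j

next-rimPred : ∀ {m} (i : Fin m) → next m (toℕ (rimPred i)) ≡ toℕ i
next-rimPred {suc m} fz     = next-wrap (cong suc (toℕ-fromℕ m))
next-rimPred {suc m} (fs j) = trans (cong (next (suc m)) (toℕ-inject₁ j))
  (next-step (<⇒≢ (toℕ<n j) ∘ suc-injective))

rimSucc≢rimPred : ∀ {m} (i : Fin m) → 2 < m → rimSucc i ≢ rimPred i
rimSucc≢rimPred {m} i 2<m s≡p = iterate-next-≢ (toℕ i) 2 (s≤s z≤n) 2<m (begin
  next m (next m (toℕ i))   ≡⟨ cong (next m) (sym (toℕ-rimSucc i)) ⟩
  next m (toℕ (rimSucc i))  ≡⟨ cong (next m ∘ toℕ) s≡p ⟩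
  next m (toℕ (rimPred i))  ≡⟨ next-rimPred i ⟩
  toℕ i                     ∎)
  where open ≡-Reasoning

∑-rimAdj : ∀ {m} (i : Fin m) (g : Fin m → ℕ) → 2 < m →
  ∑ (λ j → if rimAdj m i j then g j else 0) ≡ g (rimSucc i) + g (rimPred i)
∑-rimAdj {m} i g 2<m = begin
  ∑ (λ j → if rimAdj m i j then g j else 0)   ≡⟨ sum-cong-≗ split ⟩
  ∑ (λ j → δ (rimSucc i) j + δ (rimPred i) j) ≡⟨ ∑-distrib-+ (δ (rimSucc i)) (δ (rimPred i)) ⟩
  ∑ (δ (rimSucc i)) + ∑ (δ (rimPred i))      ≡⟨ cong₂ _+_ (∑-indicator (rimSucc i) g) (∑-indicator (rimPred i) g) ⟩
  g (rimSucc i) + g (rimPred i)               ∎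
  where
  open ≡-Reasoning
  1<m : 1 < m
  1<m = <-trans (s≤s (s≤s z≤n)) 2<m
  δ : Fin m → Fin m → ℕ
  δ a j = if does (j ≟F a) then g j else 0
  split : ∀ j → (if rimAdj m i j then g j else 0) ≡ δ (rimSucc i) j + δ (rimPred i) j
  split j with j ≟F rimSucc i | j ≟F rimPred i
  ... | yes refl | yes s≡p = contradiction s≡p (rimSucc≢rimPred i 2<m)
  ... | yes refl | no _ rewrite rimAdj⇐ 1<m (inj₁ (toℕ-rimSucc i)) = sym (+-identityʳ _)
  ... | no _ | yes refl rewrite rimAdj⇐ 1<m (inj₂ (next-rimPred i)) = refl
  ... | no j≢s | no j≢p with rimAdj m i j in adj
  ...   | false = refl
  ...   | true with rimAdj⇒ adj
  ...     | inj₁ e = contradiction (toℕ-injective (trans e (sym (toℕ-rimSucc i)))) j≢s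
  ...     | inj₂ e = contradiction (toℕ-injective (next-injective {m} (trans e (sym (next-rimPred i))))) j≢p

sum-nbrs : ∀ G v (h : Fin (order G) → ℕ) →
  sum (map h (nbrs G v)) ≡ ∑ (λ u → if adj G v u then h u else 0)
sum-nbrs G v h = begin
  sum (map h (nbrs G v))                                                        ≡⟨ sum-map-filter adj? h (allFin _) ⟩
  sum (map (λ u → if does (adj? u) then h u else 0) (allFin (order G)))          ≡⟨ sum-map-allFin (λ u → if does (adj? u) then h u else 0) ⟩
  ∑ (λ u → if does (adj? u) then h u else 0)                                      ≡⟨ sum-cong-≗ (λ u → if-does (adj G v u)) ⟩
  ∑ (λ u → if adj G v u then h u else 0)                                          ∎
  where
  open ≡-Reasoning
  adj? : Decidable (Adj G v)
  adj? u = adj G v u Bool.≟ true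
  if-does : ∀ b {x} → (if does (b Bool.≟ true) then x else 0) ≡ (if b then x else 0)
  if-does true  = refl
  if-does false = refl

module _ {m : ℕ} where

  sum-nbrs-hub : (h : Fin (suc m) → ℕ) → sum (map h (nbrs (wheel m) fz)) ≡ ∑ (h ∘ fs)
  sum-nbrs-hub = sum-nbrs (wheel m) fz

  sum-nbrs-rim : (i : Fin m) (h : Fin (suc m) → ℕ) → 2 < m →
    sum (map h (nbrs (wheel m) (fs i))) ≡ h fz + (h (fs (rimSucc i)) + h (fs (rimPred i)))
  sum-nbrs-rim i h 2<m = trans (sum-nbrs (wheel m) (fs i) h) (cong (h fz +_) (∑-rimAdj i (h ∘ fs) 2<m))

  degree-hub : degree (wheel m) fz ≡ m
  degree-hub = trans (length≡sum-map-1 (nbrs (wheel m) fz)) (trans (sum-nbrs-hub (λ _ → 1)) (∑-1 m))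
    where
    ∑-1 : ∀ n → ∑ {n} (λ _ → 1) ≡ n
    ∑-1 zero    = refl
    ∑-1 (suc n) = cong suc (∑-1 n)

  degree-rim : (i : Fin m) → 2 < m → degree (wheel m) (fs i) ≡ 3
  degree-rim i 2<m = trans (length≡sum-map-1 (nbrs (wheel m) (fs i))) (sum-nbrs-rim i (λ _ → 1) 2<m)

  maxDegree-wheel : 2 < m → maxDegree (wheel m) ≡ m
  maxDegree-wheel 2<m rewrite degree-hub = m≥n⇒m⊔n≡m (foldr-⊔-lub (map⁺ (tabulate⁺ rim≤)))
    where
    foldr-⊔-lub : ∀ {xs b} → All (_≤ b) xs → foldr _⊔_ 0 xs ≤ b
    foldr-⊔-lub []         = z≤n
    foldr-⊔-lub (x≤ ∷ xs≤) = ⊔-lub x≤ (foldr-⊔-lub xs≤)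
    rim≤ : (i : Fin m) → degree (wheel m) (fs i) ≤ m
    rim≤ i = subst (_≤ m) (sym (degree-rim i 2<m)) 2<m

-- Wheels with at least five rim vertices

module LargeWheel (m : ℕ) (5≤m : 5 ≤ m) where

  N : ℕ → ℕ
  N = next m

  private
    N-iterate-≢ : ∀ k x → 0 < k → k ≤ 4 → iterate N x k ≢ x
    N-iterate-≢ k x 0<k k≤4 = iterate-next-≢ x k 0<k (<-≤-trans (s≤s k≤4) 5≤m)

  N¹≢ : ∀ x → N x ≢ x
  N¹≢ x = N-iterate-≢ 1 x (s≤s z≤n) (s≤s z≤n)
  N²≢ : ∀ x → N (N x) ≢ x
  N²≢ x = N-iterate-≢ 2 x (s≤s z≤n) (s≤s (s≤s z≤n))
  N³≢ : ∀ x → N (N (N x)) ≢ x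
  N³≢ x = N-iterate-≢ 3 x (s≤s z≤n) (s≤s (s≤s (s≤s z≤n)))
  N⁴≢ : ∀ x → N (N (N (N x))) ≢ x
  N⁴≢ x = N-iterate-≢ 4 x (s≤s z≤n) ≤-refl

  2<m : 2 < m
  2<m = ≤-trans (s≤s (s≤s (s≤s z≤n))) 5≤m

  N< : ∀ {x} → x < m → N x < m
  N< = next-< {m}

  -- The rim edge from x to N x gets colour 1 + N³ x; the value on non-adjacent pairs is irrelevant.
  rimEdgeColour : ℕ → ℕ → ℕ
  rimEdgeColour x y = if N x ≡ᵇ y then suc (N (N (N x))) else suc (N (N (N y)))

  colouring : TotalColoring (wheel m)
  colouring = record { vcol = vertexColour ; ecol = edgeColour }
    where
    vertexColour : Fin (suc m) → ℕ
    vertexColour fz     = suc m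
    vertexColour (fs i) = suc (N (toℕ i))
    edgeColour : Fin (suc m) → Fin (suc m) → ℕ
    edgeColour fz     fz     = 0
    edgeColour fz     (fs j) = suc (toℕ j)
    edgeColour (fs i) fz     = suc (toℕ i)
    edgeColour (fs i) (fs j) = rimEdgeColour (toℕ i) (toℕ j)

  rimEdgeColour-forward : ∀ x → rimEdgeColour x (N x) ≡ suc (N (N (N x)))
  rimEdgeColour-forward x with N x ≡ᵇ N x | ≡⇒≡ᵇ (N x) (N x) refl
  ... | true | _ = refl

  rimEdgeColour-backward : ∀ x y → N y ≡ x → rimEdgeColour x y ≡ suc (N (N x))
  rimEdgeColour-backward x y refl with N (N y) ≡ᵇ y | ≡ᵇ⇒≡ (N (N y)) y
  ... | true  | to≡ = contradiction (to≡ tt) (N²≢ y)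
  ... | false | _   = refl

  rimEdgeColour-cases : ∀ {i j : Fin m} → rimAdj m i j ≡ true →
    (toℕ j ≡ N (toℕ i) × rimEdgeColour (toℕ i) (toℕ j) ≡ suc (N (N (N (toℕ i)))))
    ⊎ (N (toℕ j) ≡ toℕ i × rimEdgeColour (toℕ i) (toℕ j) ≡ suc (N (N (toℕ i))))
  rimEdgeColour-cases {i} {j} adj with rimAdj⇒ adj
  ... | inj₁ e = inj₁ (e , trans (cong (rimEdgeColour (toℕ i)) e) (rimEdgeColour-forward (toℕ i)))
  ... | inj₂ e = inj₂ (e , rimEdgeColour-backward (toℕ i) (toℕ j) e)

  private
    c : TotalColoring (wheel m)
    c = colouring

  suc-colour : ∀ {x} → x < m → suc x ∈[1, m + 1 ]
  suc-colour x<m = s≤s z≤n , ≤-trans x<m (m≤m+n m 1)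

  vertexColour-range : ∀ v → vcol c v ∈[1, m + 1 ]
  vertexColour-range fz     = s≤s z≤n , ≤-reflexive (+-comm 1 m)
  vertexColour-range (fs i) = suc-colour (N< (toℕ<n i))

  edgeColour-range : ∀ u v → Adj (wheel m) u v → ecol c u v ∈[1, m + 1 ]
  edgeColour-range fz     (fs j) _ = suc-colour (toℕ<n j)
  edgeColour-range (fs i) fz     _ = suc-colour (toℕ<n i)
  edgeColour-range (fs i) (fs j) _ with N (toℕ i) ≡ᵇ toℕ j
  ... | true  = suc-colour (N< (N< (N< (toℕ<n i))))
  ... | false = suc-colour (N< (N< (N< (toℕ<n j))))

  edgeColour-sym : ∀ u v → Adj (wheel m) u v → ecol c u v ≡ ecol c v u
  edgeColour-sym fz     (fs j) _ = refl
  edgeColour-sym (fs i) fz     _ = refl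
  edgeColour-sym (fs i) (fs j) adj
    with rimEdgeColour-cases adj | rimEdgeColour-cases (trans (wheelAdj-sym m (fs j) (fs i)) adj)
  ... | inj₁ (j≡Ni , e₁) | inj₂ (_ , e₂) rewrite e₁ | e₂ | j≡Ni = refl
  ... | inj₂ (Nj≡i , e₁) | inj₁ (i≡Nj , e₂) rewrite e₁ | e₂ | i≡Nj = refl
  ... | inj₁ (j≡Ni , _)  | inj₁ (i≡Nj , _)  = contradiction (trans (cong N (sym j≡Ni)) (sym i≡Nj)) (N²≢ (toℕ i))
  ... | inj₂ (Nj≡i , _)  | inj₂ (Ni≡j , _)  = contradiction (trans (cong N Ni≡j) Nj≡i) (N²≢ (toℕ i))

  vertex-proper : ∀ u v → Adj (wheel m) u v → vcol c u ≢ vcol c v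
  vertex-proper fz     (fs j) _ e = <-irrefl (sym (suc-injective e)) (N< (toℕ<n j))
  vertex-proper (fs i) fz     _ e = <-irrefl (suc-injective e) (N< (toℕ<n i))
  vertex-proper (fs i) (fs j) adj e with rimEdgeColour-cases adj
  ... | inj₁ (j≡Ni , _) = N¹≢ (N (toℕ i)) (trans (cong N (sym j≡Ni)) (sym (suc-injective e)))
  ... | inj₂ (Nj≡i , _) = N¹≢ (toℕ i) (trans (suc-injective e) Nj≡i)

  incidence-proper : ∀ u v → Adj (wheel m) u v → ecol c u v ≢ vcol c u
  incidence-proper fz     (fs j) _ e = <-irrefl (suc-injective e) (toℕ<n j)
  incidence-proper (fs i) fz     _ e = N¹≢ (toℕ i) (sym (suc-injective e))
  incidence-proper (fs i) (fs j) adj e with rimEdgeColour-cases adj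
  ... | inj₁ (_ , e′) = N²≢ (N (toℕ i)) (suc-injective (trans (sym e′) e))
  ... | inj₂ (_ , e′) = N¹≢ (N (toℕ i)) (suc-injective (trans (sym e′) e))

  edge-proper : ∀ v u w → Adj (wheel m) v u → Adj (wheel m) v w → u ≢ w → ecol c v u ≢ ecol c v w
  edge-proper fz     (fs a) (fs b) _ _ a≢b e = a≢b (cong fs (toℕ-injective (suc-injective e)))
  edge-proper (fs i) fz     fz     _ _ u≢w _ = u≢w refl
  edge-proper (fs i) fz     (fs j) _ adj _ e with rimEdgeColour-cases adj
  ... | inj₁ (_ , e′) = N³≢ (toℕ i) (sym (suc-injective (trans e e′)))
  ... | inj₂ (_ , e′) = N²≢ (toℕ i) (sym (suc-injective (trans e e′)))
  edge-proper (fs i) (fs j) fz     adj _ _ e with rimEdgeColour-cases adj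
  ... | inj₁ (_ , e′) = N³≢ (toℕ i) (suc-injective (trans (sym e′) e))
  ... | inj₂ (_ , e′) = N²≢ (toℕ i) (suc-injective (trans (sym e′) e))
  edge-proper (fs i) (fs j) (fs k) adj₁ adj₂ j≢k e with rimEdgeColour-cases adj₁ | rimEdgeColour-cases adj₂
  ... | inj₁ (j≡Ni , _) | inj₁ (k≡Ni , _) = j≢k (cong fs (toℕ-injective (trans j≡Ni (sym k≡Ni))))
  ... | inj₂ (Nj≡i , _) | inj₂ (Nk≡i , _) = j≢k (cong fs (toℕ-injective (next-injective {m} (trans Nj≡i (sym Nk≡i)))))
  ... | inj₁ (_ , e₁)   | inj₂ (_ , e₂)   = N¹≢ (N (N (toℕ i))) (suc-injective (trans (sym e₁) (trans e e₂)))
  ... | inj₂ (_ , e₁)   | inj₁ (_ , e₂)   = N¹≢ (N (N (toℕ i))) (suc-injective (trans (sym e₂) (trans (sym e) e₁)))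

  rimWeight : ℕ → ℕ
  rimWeight x = suc (N x) + (suc x + (suc (N (N (N x))) + suc (N (N x))))

  weight-rim : ∀ i → weight (wheel m) c (fs i) ≡ rimWeight (toℕ i)
  weight-rim i = cong (suc (N (toℕ i)) +_) (begin
    sum (map (ecol c (fs i)) (nbrs (wheel m) (fs i)))
      ≡⟨ sum-nbrs-rim i (ecol c (fs i)) 2<m ⟩
    suc (toℕ i) + (rimEdgeColour (toℕ i) (toℕ (rimSucc i)) + rimEdgeColour (toℕ i) (toℕ (rimPred i)))
      ≡⟨ cong (suc (toℕ i) +_) (cong₂ _+_
           (trans (cong (rimEdgeColour (toℕ i)) (toℕ-rimSucc i)) (rimEdgeColour-forward (toℕ i)))
           (rimEdgeColour-backward (toℕ i) (toℕ (rimPred i)) (next-rimPred i))) ⟩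
    suc (toℕ i) + (suc (N (N (N (toℕ i)))) + suc (N (N (toℕ i)))) ∎)
    where open ≡-Reasoning

  rimWeight-≢ : ∀ x → rimWeight x ≢ rimWeight (N x)
  rimWeight-≢ x e = N⁴≢ x (sym (+-cancelʳ-≡ _ x (N⁴ x) (begin
    x + S          ≡⟨ by-x x (N x) (N (N x)) (N (N (N x))) ⟩
    rimWeight x    ≡⟨ e ⟩
    rimWeight (N x) ≡⟨ by-N⁴ (N x) (N (N x)) (N (N (N x))) (N⁴ x) ⟩
    N⁴ x + S       ∎)))
    where
    open ≡-Reasoning
    N⁴ : ℕ → ℕ
    N⁴ y = N (N (N (N y)))
    S : ℕ
    S = 4 + N x + N (N x) + N (N (N x))
    by-x : ∀ a b c d → a + (4 + b + c + d) ≡ suc b + (suc a + (suc d + suc c))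
    by-x = solve-∀
    by-N⁴ : ∀ b c d e → suc c + (suc b + (suc e + suc d)) ≡ e + (4 + b + c + d)
    by-N⁴ = solve-∀

  weight-hub : 2 * weight (wheel m) c fz ≡ 2 * suc m + m * suc m
  weight-hub = begin
    2 * weight (wheel m) c fz                   ≡⟨ cong (λ t → 2 * (suc m + t)) (sum-nbrs-hub (ecol c fz)) ⟩
    2 * (suc m + ∑ spoke)                       ≡⟨ *-distribˡ-+ 2 (suc m) (∑ spoke) ⟩
    2 * suc m + 2 * ∑ spoke                     ≡⟨ cong (2 * suc m +_) (injective-colours-sum m spoke spoke-range spoke-injective) ⟩
    2 * suc m + m * suc m                       ∎
    where
    open ≡-Reasoning
    spoke : Fin m → ℕ
    spoke j = suc (toℕ j)
    spoke-range : ∀ j → spoke j ∈[1, m ]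
    spoke-range j = s≤s z≤n , toℕ<n j
    spoke-injective : Injective _≡_ _≡_ spoke
    spoke-injective e = toℕ-injective (suc-injective e)

  rimWeight<weight-hub : ∀ i → rimWeight (toℕ i) < weight (wheel m) c fz
  rimWeight<weight-hub i = *-cancelˡ-< 2 _ _ (begin-strict
    2 * rimWeight x                     ≤⟨ *-monoʳ-≤ 2 (+-mono-≤ (N< x<m) (+-mono-≤ x<m (+-mono-≤ (N< (N< (N< x<m))) (N< (N< x<m))))) ⟩
    2 * (m + (m + (m + m)))             <⟨ slack m ⟩
    2 * suc m + m * 6                   ≤⟨ +-monoʳ-≤ (2 * suc m) (*-monoʳ-≤ m (s≤s 5≤m)) ⟩
    2 * suc m + m * suc m               ≡⟨ sym weight-hub ⟩
    2 * weight (wheel m) c fz           ∎)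
    where
    open ≤-Reasoning
    x : ℕ
    x = toℕ i
    x<m : x < m
    x<m = toℕ<n i
    slack : ∀ m → 2 * (m + (m + (m + m))) < 2 * suc m + m * 6
    slack m = subst (2 * (m + (m + (m + m))) <_) (expand m) (m<n+m _ {2} (s≤s z≤n))
      where
      expand : ∀ m → 2 + 2 * (m + (m + (m + m))) ≡ 2 * suc m + m * 6
      expand = solve-∀

  sums-distinct : ∀ u v → Adj (wheel m) u v → weight (wheel m) c u ≢ weight (wheel m) c v
  sums-distinct fz     (fs j) _ e = <-irrefl (trans (sym (weight-rim j)) (sym e)) (rimWeight<weight-hub j)
  sums-distinct (fs i) fz     _ e = <-irrefl (trans (sym (weight-rim i)) e) (rimWeight<weight-hub i)
  sums-distinct (fs i) (fs j) adj e with rimEdgeColour-cases adj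
  ... | inj₁ (j≡Ni , _) = rimWeight-≢ (toℕ i)
    (trans (sym (weight-rim i)) (trans e (trans (weight-rim j) (cong rimWeight j≡Ni))))
  ... | inj₂ (Nj≡i , _) = rimWeight-≢ (toℕ j)
    (trans (sym (weight-rim j)) (trans (sym e) (trans (weight-rim i) (cong rimWeight (sym Nj≡i)))))

  isAVDTotalColoring : IsAVDTotalColoring (wheel m) (m + 1) colouring
  isAVDTotalColoring = record
    { vcol-range       = vertexColour-range
    ; ecol-range       = edgeColour-range
    ; ecol-sym         = edgeColour-sym
    ; vertex-proper    = vertex-proper
    ; edge-proper      = edge-proper
    ; incidence-proper = incidence-proper
    ; sums-distinct    = sums-distinct
    }

-- Deciding whether a colouring distinguishes adjacent vertices

module _ (G : Graph) (k : ℕ) (c : TotalColoring G) where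
  private
    adj? : ∀ u v → Dec (Adj G u v)
    adj? u v = adj G u v Bool.≟ true

  isAVDTotalColoring? : Dec (IsAVDTotalColoring G k c)
  isAVDTotalColoring? = map′
    (λ (a , b , d , e , f , g , h) → record
      { vcol-range = a ; ecol-range = b ; ecol-sym = d ; vertex-proper = e
      ; edge-proper = f ; incidence-proper = g ; sums-distinct = h })
    (λ P → let open IsAVDTotalColoring P in
      vcol-range , ecol-range , ecol-sym , vertex-proper , edge-proper , incidence-proper , sums-distinct)
    (all? (λ v → (1 ≤? vcol c v) ×-dec (vcol c v ≤? k))
    ×-dec all? (λ u → all? λ v → adj? u v →-dec (1 ≤? ecol c u v) ×-dec (ecol c u v ≤? k))
    ×-dec all? (λ u → all? λ v → adj? u v →-dec ecol c u v ≟ ecol c v u)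
    ×-dec all? (λ u → all? λ v → adj? u v →-dec ¬? (vcol c u ≟ vcol c v))
    ×-dec all? (λ v → all? λ u → all? λ w →
            adj? v u →-dec adj? v w →-dec ¬? (u ≟F w) →-dec ¬? (ecol c v u ≟ ecol c v w))
    ×-dec all? (λ u → all? λ v → adj? u v →-dec ¬? (ecol c u v ≟ vcol c u))
    ×-dec all? (λ u → all? λ v → adj? u v →-dec ¬? (weight G c u ≟ weight G c v)))

-- Small wheels

-- Each edge is listed once; the other orientation and all non-edges read 0.
symmetrise : ∀ {n} → (Fin n → Fin n → ℕ) → Fin n → Fin n → ℕ
symmetrise t u v = t u v ⊔ t v u

W₄-colouring : TotalColoring (wheel 4)
W₄-colouring = record { vcol = vertexColour ; ecol = symmetrise edgeColour }
  where
  vertexColour : Fin 5 → ℕ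
  vertexColour 0F = 1
  vertexColour 1F = 2
  vertexColour 2F = 3
  vertexColour 3F = 2
  vertexColour 4F = 3
  edgeColour : Fin 5 → Fin 5 → ℕ
  edgeColour 0F 1F = 3
  edgeColour 0F 2F = 2
  edgeColour 0F 3F = 4
  edgeColour 0F 4F = 5
  edgeColour 1F 2F = 1
  edgeColour 2F 3F = 5
  edgeColour 3F 4F = 1
  edgeColour 4F 1F = 4
  edgeColour _  _  = 0

W₃-colouring : TotalColoring (wheel 3)
W₃-colouring = record { vcol = vertexColour ; ecol = symmetrise edgeColour }
  where
  vertexColour : Fin 4 → ℕ
  vertexColour 0F = 3
  vertexColour 1F = 4
  vertexColour 2F = 1
  vertexColour 3F = 2
  edgeColour : Fin 4 → Fin 4 → ℕ
  edgeColour 0F 1F = 5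
  edgeColour 0F 2F = 4
  edgeColour 0F 3F = 1
  edgeColour 1F 2F = 2
  edgeColour 2F 3F = 5
  edgeColour 3F 1F = 3
  edgeColour _  _  = 0

W₄-isAVD : IsAVDTotalColoring (wheel 4) 5 W₄-colouring
W₄-isAVD = from-yes (isAVDTotalColoring? (wheel 4) 5 W₄-colouring)

W₃-isAVD : IsAVDTotalColoring (wheel 3) 5 W₃-colouring
W₃-isAVD = from-yes (isAVDTotalColoring? (wheel 3) 5 W₃-colouring)

W₃-not-4-colourable : ¬ AVDColorable (wheel 3) 4
W₃-not-4-colourable (c , P) = full-stars-adjacent-⊥ P {fz} {fs fz} refl refl refl

wheel-colours-≥ : ∀ {m k} → AVDColorable (wheel m) k → m + 1 ≤ k
wheel-colours-≥ {m} {k} (c , P) = subst (_≤ k) (trans (cong suc degree-hub) (+-comm 1 m)) (degree<colours (wheel m) c fz P)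

wheel-colourable : ∀ m → 4 ≤ m → AVDColorable (wheel m) (m + 1)
wheel-colourable m 4≤m with m ≟ 4
... | yes refl = W₄-colouring , W₄-isAVD
... | no  m≢4  = LargeWheel.colouring m 5≤m , LargeWheel.isAVDTotalColoring m 5≤m
  where
  5≤m : 5 ≤ m
  5≤m = ≤∧≢⇒< 4≤m (m≢4 ∘ sym)

theorem3p2 : ∀ (m : ℕ) → 3 ≤ m →
    (4 ≤ m → χΣ≡ (wheel m) (maxDegree (wheel m) + 1))
    × (m ≡ 3 → χΣ≡ (wheel m) (maxDegree (wheel m) + 2))
theorem3p2 m 3≤m rewrite maxDegree-wheel 3≤m =
  (λ 4≤m → wheel-colourable m 4≤m , λ _ → wheel-colours-≥) ,
  λ { refl → (W₃-colouring , W₃-isAVD) , λ j A →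
        ≤∧≢⇒< (wheel-colours-≥ A) λ { refl → W₃-not-4-colourable A } }
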